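{- Let $G=K_n$ be the complete graph of order $n\geq 3$, let $G_1,G_2$ be disjoint copies of $G$ with $A=V(G_1)$, $B=V(G_2)$, let $g:A\to B$ be a function, and let $s=|g(A)|$. If $1<s<n$, then $2(n-s)-1\leq fix(F_G)\leq 2n-s-3$.
   Context: A set $S\subseteq V(H)$ is a fixing set of a graph $H$ if the only automorphism of $H$ fixing every vertex of $S$ is the identity; $fix(H)$ is the minimum cardinality of a fixing set of $H$. Functigraph: for disjoint copies $G_1,G_2$ of $G$, $A=V(G_1)$, $B=V(G_2)$ and a function $g:A\to B$, $F_G$ is the graph with vertex set $A\cup B$ and edge set $E(G_1)\cup E(G_2)\cup\{uv:u\in A,\ v=g(u)\}$. -}

module Defs where

open import Data.Nat using (ℕ; _≤_)
open import Data.Fin using (Fin; _≟_)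
open import Data.Fin.Properties using (any?)
open import Data.Fin.Subset using (Subset; ∣_∣)
open import Data.Vec using (tabulate)
open import Data.Sum using (_⊎_; inj₁; inj₂)
open import Data.Product using (Σ; _×_; ∃-syntax)
open import Data.List using (List; length)
open import Data.List.Membership.Propositional using (_∈_)
open import Data.List.Relation.Unary.Unique.Propositional using (Unique)
open import Relation.Binary.PropositionalEquality using (_≡_; _≢_)
open import Relation.Nullary using (does)
open import Function.Bundles using (_↔_; Inverse; _⇔_)

record Graph : Set₁ where
  field
    V   : Set
    Adj : V → V → Set
open Graph public

record Automorphism (H : Graph) : Set where
  field
    perm     : V H ↔ V H
    preserve : ∀ u v → Adj H u v ⇔ Adj H (Inverse.to perm u) (Inverse.to perm v)
open Automorphism public

-- A finite vertex set is a duplicate-free list; its cardinality is its length.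
-- S is a fixing set: the only automorphism fixing every vertex of S is the identity.
IsFixingSet : (H : Graph) → List (V H) → Set
IsFixingSet H S = (σ : Automorphism H) →
  (∀ v → v ∈ S → Inverse.to (perm σ) v ≡ v) → ∀ v → Inverse.to (perm σ) v ≡ v

IsFixNumber : Graph → ℕ → Set
IsFixNumber H k =
  (Σ (List (V H)) λ S → Unique S × IsFixingSet H S × length S ≡ k) ×
  (∀ (S : List (V H)) → Unique S → IsFixingSet H S → k ≤ length S)

K : ℕ → Graph
K n = record { V = Fin n ; Adj = λ i j → i ≢ j }

-- Functigraph F_G for G with copies G₁ (inj₁, vertex set A) and G₂ (inj₂, vertex set B),
-- and g : A → B.
Functigraph : (G : Graph) → (V G → V G) → Graph
Functigraph G g = record { V = V G ⊎ V G ; Adj = adj }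
  where
  adj : V G ⊎ V G → V G ⊎ V G → Set
  adj (inj₁ a) (inj₁ a′) = Adj G a a′
  adj (inj₂ b) (inj₂ b′) = Adj G b b′
  adj (inj₁ a) (inj₂ b)  = g a ≡ b
  adj (inj₂ b) (inj₁ a)  = g a ≡ b

image : ∀ {n} → (Fin n → Fin n) → Subset n
image {n} g = tabulate λ j → does (any? λ i → g i ≟ j)

imageSize : ∀ {n} → (Fin n → Fin n) → ℕ
imageSize g = ∣ image g ∣

-- Relate a, a′ ∈ A when g a = g a′ or both have singleton fibres, and relate
-- any two vertices of B outside g(A). Because 1 < s < n, the simplicial vertices of F are exactly
-- those of B outside g(A), so every automorphism maps A to A and B to B and is a pair (α, β) with
-- g ∘ α = β ∘ g. Conversely, swapping two related vertices (for singletons together with their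
-- images) is an automorphism. Hence a fixing set meets every class in all but at most one member,
-- and the vertices that are not the last of their class form a fixing set; so fix(F) equals
-- (n − L) + (n − s − 1), where L is the number of classes in A. Finally 2 ≤ L ≤ s: g is injective
-- on the last elements of the classes, and some fibre is not a singleton while g takes another value.

module Submission where

open import Defs
open import Data.Nat using (ℕ; _≤_; _<_; _*_; _∸_)
open import Data.Fin using (Fin)
open import Data.Product using (_×_; ∃-syntax)

open import Data.Empty using (⊥; ⊥-elim)
open import Data.Fin as Fin using (zero; suc; _≟_)
open import Data.Fin.Properties using (any?; all?; ¬∀⟶∃¬; <-cmp; _<?_)
import Data.Fin.Permutation as Perm
open import Data.Fin.Permutation.Components using (transpose)
open import Data.Fin.Subset using (∣_∣)
open import Data.List using (List; []; _∷_; _++_; map; filter; length; allFin)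
import Data.List
open import Data.List.Membership.Propositional using (_∈_; _∉_)
open import Data.List.Membership.Propositional.Properties
  using (∈-∃++; ∈-++⁻; ∈-++⁺ˡ; ∈-++⁺ʳ; ∈-filter⁺; ∈-filter⁻; ∈-allFin; ∈-map⁺; ∈-map⁻)
import Data.List.Membership.DecPropositional as DecMembership
open import Data.List.Properties using (length-++-sucʳ; filter-all; length-tabulate; length-++; length-map)
import Data.List.Relation.Unary.All as All
open import Data.List.Relation.Unary.AllPairs using (_∷_)
open import Data.List.Relation.Unary.Any using (here; there)
open import Data.List.Relation.Unary.Unique.Propositional using (Unique)
import Data.List.Relation.Unary.Unique.Propositional.Properties as Unique
open import Data.Nat using (zero; suc; _+_; z≤n; s≤s)
open import Data.Nat.Properties
  using (+-suc; +-comm; ≤-antisym; +-cancelˡ-≤; +-cancelˡ-<; +-identityʳ; <⇒≱; +-mono-≤; +-monoʳ-≤; +-monoˡ-≤;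
         m+n∸m≡n; m+n≤o⇒m≤o∸n; module ≤-Reasoning)
open import Data.Nat.Tactic.RingSolver using (solve-∀)
open import Data.Product using (_,_; proj₁; proj₂)
open import Data.Sum as Sum using (_⊎_; inj₁; inj₂)
open import Data.Sum.Properties using (inj₁-injective; inj₂-injective; ≡-dec)
import Data.Sum.Relation.Unary.All as SumAll
import Data.Vec as Vec
open import Function.Base using (_∘_)
open import Function.Bundles using (Inverse; _↔_; Equivalence; _⇔_; mk⇔; mk↔ₛ′; Injection)
open import Function.Definitions using (Injective)
open import Function.Properties.Inverse using (↔-sym; ↔⇒↣)
open import Level using (0ℓ)
open import Relation.Binary using (Rel; IsPartialEquivalence; tri<; tri≈; tri>)
import Relation.Binary.Definitions as Binary
open import Relation.Binary.PropositionalEquality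
open import Relation.Nullary using (yes; no; does; ¬_; ¬?)
open import Relation.Nullary.Decidable using (_×-dec_; _⊎-dec_; _→-dec_; dec-true; dec-false)
open import Relation.Unary using (Pred; Decidable; U; ∁; _∩_; _⊆_)
open import Relation.Unary.Properties using (U?; ∁?; _∩?_)

private variable
  A B : Set
  m n : ℕ

-- Counting

∈-++-skip : ∀ {x y : A} xs ys → x ∈ xs ++ y ∷ ys → x ≢ y → x ∈ xs ++ ys
∈-++-skip xs ys x∈ x≢y with ∈-++⁻ xs x∈
... | inj₁ x∈xs = ∈-++⁺ˡ x∈xs
... | inj₂ (here x≡y) = ⊥-elim (x≢y x≡y)
... | inj₂ (there x∈ys) = ∈-++⁺ʳ xs x∈ys

length-≤-injection : (f : A → B) {xs : List A} {ys : List B} → Unique xs →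
  (∀ {x} → x ∈ xs → f x ∈ ys) →
  (∀ {x y} → x ∈ xs → y ∈ xs → f x ≡ f y → x ≡ y) →
  length xs ≤ length ys
length-≤-injection f {[]} _ _ _ = z≤n
length-≤-injection f {x ∷ xs} (x∉xs ∷ xs-unique) into inj with ∈-∃++ (into (here refl))
... | ys₁ , ys₂ , refl = subst (suc (length xs) ≤_) (sym (length-++-sucʳ ys₁ (f x) ys₂))
  (s≤s (length-≤-injection f xs-unique into′ (λ x∈ y∈ → inj (there x∈) (there y∈))))
  where
  into′ : ∀ {w} → w ∈ xs → f w ∈ ys₁ ++ ys₂
  into′ w∈ = ∈-++-skip ys₁ ys₂ (into (there w∈))
    (λ fw≡fx → All.lookup x∉xs w∈ (sym (inj (there w∈) (here refl) fw≡fx)))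

count : {P : Pred (Fin n) 0ℓ} → Decidable P → ℕ
count {n} P? = length (filter P? (allFin n))

module _ {P : Pred (Fin n) 0ℓ} (P? : Decidable P) where

  filter-allFin-unique : Unique (filter P? (allFin n))
  filter-allFin-unique = Unique.filter⁺ P? (Unique.allFin⁺ n)

  ∈-filter-allFin⁺ : ∀ {x} → P x → x ∈ filter P? (allFin n)
  ∈-filter-allFin⁺ = ∈-filter⁺ P? (∈-allFin _)

  ∈-filter-allFin⁻ : ∀ {x} → x ∈ filter P? (allFin n) → P x
  ∈-filter-allFin⁻ x∈ = proj₂ (∈-filter⁻ P? {xs = allFin n} x∈)

  count-∁ : count P? + count (∁? P?) ≡ n
  count-∁ = trans (go (allFin n)) (length-tabulate (λ x → x))
    where
    go : ∀ xs → length (filter P? xs) + length (filter (∁? P?) xs) ≡ length xs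
    go [] = refl
    go (x ∷ xs) with P? x
    ... | yes _ = cong suc (go xs)
    ... | no _ = trans (+-suc _ _) (cong suc (go xs))

  count-split : {Q : Pred (Fin n) 0ℓ} (Q? : Decidable Q) → Q ⊆ P →
    count Q? + count (P? ∩? ∁? Q?) ≡ count P?
  count-split Q? Q⊆P = go (allFin n)
    where
    go : ∀ xs → length (filter Q? xs) + length (filter (P? ∩? ∁? Q?) xs) ≡ length (filter P? xs)
    go [] = refl
    go (x ∷ xs) with Q? x | P? x
    ... | yes _ | yes _ = cong suc (go xs)
    ... | yes q | no ¬p = ⊥-elim (¬p (Q⊆P q))
    ... | no _ | yes _ = trans (+-suc _ _) (cong suc (go xs))
    ... | no _ | no _ = go xs

  ∣tabulate∣≡count : ∣ Vec.tabulate (λ x → does (P? x)) ∣ ≡ count P?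
  ∣tabulate∣≡count = go n (λ x → x)
    where
    go : ∀ m (h : Fin m → Fin n) → ∣ Vec.tabulate (λ x → does (P? (h x))) ∣ ≡ length (filter P? (Data.List.tabulate h))
    go zero h = refl
    go (suc m) h with P? (h zero)
    ... | yes _ = cong suc (go m (λ x → h (suc x)))
    ... | no _ = go m (λ x → h (suc x))

count-U : count {n} U? ≡ n
count-U {n} = trans (cong length (filter-all U? (All.universal _ (allFin n)))) (length-tabulate (λ x → x))

count-≤-injection : {P : Pred (Fin m) 0ℓ} {Q : Pred (Fin n) 0ℓ} (P? : Decidable P) (Q? : Decidable Q)
  (f : Fin m → Fin n) → (∀ {x} → P x → Q (f x)) → (∀ {x y} → P x → P y → f x ≡ f y → x ≡ y) →
  count P? ≤ count Q?
count-≤-injection P? Q? f into inj = length-≤-injection f (filter-allFin-unique P?)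
  (λ x∈ → ∈-filter-allFin⁺ Q? (into (∈-filter-allFin⁻ P? x∈)))
  (λ x∈ y∈ → inj (∈-filter-allFin⁻ P? x∈) (∈-filter-allFin⁻ P? y∈))

module _ {P : Pred (Fin n) 0ℓ} (P? : Decidable P) where

  count≤1 : (∀ {x y} → P x → P y → x ≡ y) → count P? ≤ 1
  count≤1 all-equal = count-≤-injection P? (U? {A = Fin 1}) (λ _ → zero) _ (λ p q _ → all-equal p q)

  1≤count : ∀ {x} → P x → 1 ≤ count P?
  1≤count {x} p = count-≤-injection (U? {A = Fin 1}) P? (λ _ → x) (λ _ → p) λ { {zero} {zero} _ _ _ → refl }

  2≤count : ∀ {x y} → P x → P y → x ≢ y → 2 ≤ count P?
  2≤count {x} {y} p q x≢y = count-≤-injection (U? {A = Fin 2}) P? pair into inj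
    where
    pair : Fin 2 → Fin n
    pair zero = x
    pair (suc _) = y
    into : ∀ {i} → U i → P (pair i)
    into {zero} _ = p
    into {suc zero} _ = q
    inj : ∀ {i j} → U i → U j → pair i ≡ pair j → i ≡ j
    inj {zero} {zero} _ _ _ = refl
    inj {zero} {suc zero} _ _ x≡y = ⊥-elim (x≢y x≡y)
    inj {suc zero} {zero} _ _ y≡x = ⊥-elim (x≢y (sym y≡x))
    inj {suc zero} {suc zero} _ _ _ = refl

  0<count⇒∃ : 0 < count P? → ∃[ x ] P x
  0<count⇒∃ 0<count = go (filter P? (allFin n)) 0<count (∈-filter-allFin⁻ P?)
    where
    go : ∀ xs → 0 < length xs → (∀ {x} → x ∈ xs → P x) → ∃[ x ] P x
    go (x ∷ _) _ sound = x , sound (here refl)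

  1<count⇒∃≢ : 1 < count P? → ∀ x → ∃[ y ] P y × y ≢ x
  1<count⇒∃≢ 1<count x with any? (λ y → P? y ×-dec ¬? (y ≟ x))
  ... | yes found = found
  ... | no none = ⊥-elim (<⇒≱ 1<count (count≤1 λ p q → trans (only p) (sym (only q))))
    where
    only : ∀ {y} → P y → y ≡ x
    only {y} p with y ≟ x
    ... | yes y≡x = y≡x
    ... | no y≢x = ⊥-elim (none (y , p , y≢x))

module _ {P Q : Pred (Fin n) 0ℓ} (P? : Decidable P) (Q? : Decidable Q) where

  filter⊎ : List (Fin n ⊎ Fin n)
  filter⊎ = map inj₁ (filter P? (allFin n)) ++ map inj₂ (filter Q? (allFin n))

  filter⊎-unique : Unique filter⊎
  filter⊎-unique = Unique.++⁺ (Unique.map⁺ inj₁-injective (filter-allFin-unique P?))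
                              (Unique.map⁺ inj₂-injective (filter-allFin-unique Q?)) disjoint
    where
    disjoint : ∀ {v} → ¬ (v ∈ map inj₁ (filter P? (allFin n)) × v ∈ map inj₂ (filter Q? (allFin n)))
    disjoint (v∈₁ , v∈₂) with ∈-map⁻ inj₁ v∈₁ | ∈-map⁻ inj₂ v∈₂
    ... | _ , _ , refl | _ , _ , ()

  length-filter⊎ : length filter⊎ ≡ count P? + count Q?
  length-filter⊎ = trans (length-++ (map inj₁ (filter P? (allFin n))))
                         (cong₂ _+_ (length-map inj₁ (filter P? (allFin n))) (length-map inj₂ (filter Q? (allFin n))))

  ∈-filter⊎⁺ : ∀ {v} → SumAll.All P Q v → v ∈ filter⊎
  ∈-filter⊎⁺ (SumAll.inj₁ p) = ∈-++⁺ˡ (∈-map⁺ inj₁ (∈-filter-allFin⁺ P? p))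
  ∈-filter⊎⁺ (SumAll.inj₂ q) = ∈-++⁺ʳ (map inj₁ (filter P? (allFin n))) (∈-map⁺ inj₂ (∈-filter-allFin⁺ Q? q))

  ∈-filter⊎⁻ : ∀ {v} → v ∈ filter⊎ → SumAll.All P Q v
  ∈-filter⊎⁻ v∈ with ∈-++⁻ (map inj₁ (filter P? (allFin n))) v∈
  ... | inj₁ v∈₁ with ∈-map⁻ inj₁ v∈₁
  ...   | _ , a∈ , refl = SumAll.inj₁ (∈-filter-allFin⁻ P? a∈)
  ∈-filter⊎⁻ v∈ | inj₂ v∈₂ with ∈-map⁻ inj₂ v∈₂
  ...   | _ , b∈ , refl = SumAll.inj₂ (∈-filter-allFin⁻ Q? b∈)

-- x and y count the vertices of A and of B that are not last in their class; L counts the classes in A.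
bounds-from-class-count : ∀ {n s x y L} → x + L ≡ n → s + (y + 1) ≡ n → 2 ≤ L → L ≤ s →
  2 * (n ∸ s) ∸ 1 ≤ x + y × x + y ≤ 2 * n ∸ s ∸ 3
bounds-from-class-count {s = s} {x} {y} {L} refl split 2≤L L≤s = lower , upper
  where
  open ≤-Reasoning
  y<x : y + 1 ≤ x
  y<x = +-cancelˡ-≤ s (y + 1) x (begin
    s + (y + 1) ≡⟨ split ⟩
    x + L       ≤⟨ +-monoʳ-≤ x L≤s ⟩
    x + s       ≡⟨ +-comm x s ⟩
    s + x       ∎)
  double : ∀ y → 2 * (y + 1) ≡ 1 + (y + 1 + y)
  double = solve-∀
  n∸s≡y+1 : x + L ∸ s ≡ y + 1
  n∸s≡y+1 = trans (cong (_∸ s) (sym split)) (m+n∸m≡n s (y + 1))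
  lower : 2 * (x + L ∸ s) ∸ 1 ≤ x + y
  lower = begin
    2 * (x + L ∸ s) ∸ 1     ≡⟨ cong (λ m → 2 * m ∸ 1) n∸s≡y+1 ⟩
    2 * (y + 1) ∸ 1         ≡⟨ cong (_∸ 1) (double y) ⟩
    y + 1 + y               ≤⟨ +-monoˡ-≤ y y<x ⟩
    x + y                   ∎
  rearrange : ∀ x y s → x + y + 3 + s ≡ (x + 2) + (s + (y + 1))
  rearrange = solve-∀
  twice : ∀ m → m + m ≡ 2 * m
  twice = solve-∀
  upper : x + y ≤ 2 * (x + L) ∸ s ∸ 3
  upper = m+n≤o⇒m≤o∸n (x + y) (m+n≤o⇒m≤o∸n (x + y + 3) (begin
    x + y + 3 + s             ≡⟨ rearrange x y s ⟩
    (x + 2) + (s + (y + 1))   ≤⟨ +-monoˡ-≤ (s + (y + 1)) (+-monoʳ-≤ x 2≤L) ⟩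
    (x + L) + (s + (y + 1))   ≡⟨ cong (x + L +_) split ⟩
    (x + L) + (x + L)         ≡⟨ twice (x + L) ⟩
    2 * (x + L)               ∎))

-- Partial equivalence relations on Fin n

greatest : {P : Pred (Fin n) 0ℓ} → Decidable P → ∃[ x ] P x →
  ∃[ y ] P y × (∀ {z} → y Fin.< z → ¬ P z)
greatest {suc n} {P} P? (x , px) with any? (λ z → P? (suc z))
... | yes p₊ with greatest (λ z → P? (suc z)) p₊
...   | y , py , above = suc y , py , λ { {zero} () ; {suc z} (s≤s y<z) → above y<z }
greatest {suc n} {P} P? (x , px) | no ¬p₊ = zero , P-zero x px , λ { {zero} () ; {suc z} _ pz → ¬p₊ (z , pz) }
  where
  P-zero : ∀ x → P x → P zero
  P-zero zero px = px
  P-zero (suc x) px = ⊥-elim (¬p₊ (x , px))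

module PartialEquivalence {R : Rel (Fin n) 0ℓ} (R? : Binary.Decidable R) (isPER : IsPartialEquivalence R) where
  open IsPartialEquivalence isPER renaming (sym to R-sym; trans to R-trans)

  NotLast : Pred (Fin n) 0ℓ
  NotLast x = ∃[ y ] x Fin.< y × R x y

  NotLast? : Decidable NotLast
  NotLast? x = any? (λ y → (x <? y) ×-dec R? x y)

  NotLast⇒reflexive : ∀ {x} → NotLast x → R x x
  NotLast⇒reflexive (_ , _ , r) = R-trans r (R-sym r)

  last : Fin n → Fin n
  last x with any? (R? x)
  ... | yes related = proj₁ (greatest (R? x) related)
  ... | no _ = x

  last-spec : ∀ {x} → R x x → R x (last x) × (∀ {z} → last x Fin.< z → ¬ R x z)
  last-spec {x} r with any? (R? x)
  ... | yes related = proj₂ (greatest (R? x) related)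
  ... | no none = ⊥-elim (none (x , r))

  last-related : ∀ {x} → R x x → R x (last x)
  last-related r = proj₁ (last-spec r)

  last-not-NotLast : ∀ {x} → R x x → ¬ NotLast (last x)
  last-not-NotLast r (z , last<z , r′) = proj₂ (last-spec r) last<z (R-trans (last-related r) r′)

  NotLast-or-NotLast : ∀ {x y} → R x y → x ≢ y → NotLast x ⊎ NotLast y
  NotLast-or-NotLast {x} {y} r x≢y with <-cmp x y
  ... | tri< x<y _ _ = inj₁ (y , x<y , r)
  ... | tri≈ _ x≡y _ = ⊥-elim (x≢y x≡y)
  ... | tri> _ _ y<x = inj₂ (x , y<x , R-sym r)

  last-unique : ∀ {x y} → R x y → ¬ NotLast x → ¬ NotLast y → x ≡ y
  last-unique {x} {y} r x-last y-last with x ≟ y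
  ... | yes x≡y = x≡y
  ... | no x≢y with NotLast-or-NotLast r x≢y
  ...   | inj₁ x-notLast = ⊥-elim (x-last x-notLast)
  ...   | inj₂ y-notLast = ⊥-elim (y-last y-notLast)

  -- A last element cannot move up, and if it moved down its image would be a fixed NotLast element.
  class-preserving-injection-fixes : (h : Fin n → Fin n) → Injective _≡_ _≡_ h →
    (∀ {x} → R x x → R x (h x)) → (∀ {x} → NotLast x → h x ≡ x) → ∀ {x} → R x x → h x ≡ x
  class-preserving-injection-fixes h h-inj preserves fixes {x} r with NotLast? x
  ... | yes notLast = fixes notLast
  ... | no isLast with <-cmp x (h x)
  ...   | tri< x<hx _ _ = ⊥-elim (isLast (h x , x<hx , preserves r))
  ...   | tri≈ _ x≡hx _ = sym x≡hx
  ...   | tri> _ _ hx<x = h-inj (fixes (x , hx<x , R-sym (preserves r)))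

  -- NotLast x is charged to x when T x, and otherwise to the last element of its class,
  -- which then satisfies T.
  count-NotLast-≤ : {T : Pred (Fin n) 0ℓ} (T? : Decidable T) →
    (∀ {x y} → R x y → x ≢ y → T x ⊎ T y) → count NotLast? ≤ count T?
  count-NotLast-≤ {T} T? hits = count-≤-injection NotLast? T? witness into injective
    where
    witness : Fin n → Fin n
    witness x with T? x
    ... | yes _ = x
    ... | no _ = last x

    last≢ : ∀ {x} → NotLast x → x ≢ last x
    last≢ notLast x≡last = last-not-NotLast (NotLast⇒reflexive notLast) (subst NotLast x≡last notLast)

    into : ∀ {x} → NotLast x → T (witness x)
    into {x} notLast with T? x
    ... | yes t = t
    ... | no ¬t with hits (last-related (NotLast⇒reflexive notLast)) (last≢ notLast)
    ...   | inj₁ t = ⊥-elim (¬t t)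
    ...   | inj₂ t = t

    injective : ∀ {x y} → NotLast x → NotLast y → witness x ≡ witness y → x ≡ y
    injective {x} {y} nx ny eq with T? x | T? y
    ... | yes _ | yes _ = eq
    ... | yes _ | no _ = ⊥-elim (last-not-NotLast (NotLast⇒reflexive ny) (subst NotLast eq nx))
    ... | no _ | yes _ = ⊥-elim (last-not-NotLast (NotLast⇒reflexive nx) (subst NotLast (sym eq) ny))
    ... | no ¬tx | no ¬ty with x ≟ y
    ...   | yes x≡y = x≡y
    ...   | no x≢y with hits (R-trans (last-related (NotLast⇒reflexive nx))
                                (subst (λ z → R z y) (sym eq) (R-sym (last-related (NotLast⇒reflexive ny))))) x≢y
    ...     | inj₁ tx = ⊥-elim (¬tx tx)
    ...     | inj₂ ty = ⊥-elim (¬ty ty)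

-- Transpositions

module _ {n} (i j : Fin n) where

  transpose-ˡ : transpose i j i ≡ j
  transpose-ˡ rewrite dec-true (i ≟ i) refl = refl

  transpose-ʳ : transpose i j j ≡ i
  transpose-ʳ with j ≟ i
  ... | yes j≡i = j≡i
  ... | no _ rewrite dec-true (j ≟ j) refl = refl

transpose-other : ∀ {n} {i j k : Fin n} → k ≢ i → k ≢ j → transpose i j k ≡ k
transpose-other {i = i} {j} {k} k≢i k≢j rewrite dec-false (k ≟ i) k≢i | dec-false (k ≟ j) k≢j = refl

module _ {i j : Fin n} where

  transpose-fibre : (f : Fin n → A) → f i ≡ f j → ∀ k → f (transpose i j k) ≡ f k
  transpose-fibre f fi≡fj k with k ≟ i
  ... | yes refl = sym fi≡fj
  ... | no _ with k ≟ j
  ...   | yes refl = fi≡fj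
  ...   | no _ = refl

  transpose-natural : (f : Fin n → Fin m) → (∀ {k} → f k ≡ f i → k ≡ i) → (∀ {k} → f k ≡ f j → k ≡ j) →
    ∀ k → f (transpose i j k) ≡ transpose (f i) (f j) (f k)
  transpose-natural f only-i only-j k with k ≟ i
  ... | yes refl = sym (transpose-ˡ (f k) (f j))
  ... | no k≢i with k ≟ j
  ...   | yes refl = sym (transpose-ʳ (f i) (f k))
  ...   | no k≢j = sym (transpose-other (λ e → k≢i (only-i e)) (λ e → k≢j (only-j e)))

-- Graph automorphisms

module _ {H : Graph} where

  infixr 5 _⟨$⟩_
  _⟨$⟩_ : Automorphism H → V H → V H
  σ ⟨$⟩ v = Inverse.to (perm σ) v

  _⁻¹ : Automorphism H → Automorphism H
  σ ⁻¹ = record { perm = ↔-sym (perm σ) ; preserve = preserve⁻¹ }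
    where
    open Inverse (perm σ) using (from; strictlyInverseˡ)
    preserve⁻¹ : ∀ u v → Adj H u v ⇔ Adj H (from u) (from v)
    preserve⁻¹ u v = mk⇔
      (λ a → Equivalence.from (preserve σ (from u) (from v))
               (subst₂ (Adj H) (sym (strictlyInverseˡ u)) (sym (strictlyInverseˡ v)) a))
      (λ a → subst₂ (Adj H) (strictlyInverseˡ u) (strictlyInverseˡ v)
               (Equivalence.to (preserve σ (from u) (from v)) a))

  module _ (σ : Automorphism H) where

    ⟨$⟩-preserves : ∀ {u w} → Adj H u w → Adj H (σ ⟨$⟩ u) (σ ⟨$⟩ w)
    ⟨$⟩-preserves {u} {w} = Equivalence.to (preserve σ u w)

    ⟨$⟩-reflects : ∀ {u w} → Adj H (σ ⟨$⟩ u) (σ ⟨$⟩ w) → Adj H u w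
    ⟨$⟩-reflects {u} {w} = Equivalence.from (preserve σ u w)

    ⟨$⟩-⁻¹ : ∀ v → σ ⟨$⟩ σ ⁻¹ ⟨$⟩ v ≡ v
    ⟨$⟩-⁻¹ = Inverse.strictlyInverseˡ (perm σ)

    ⁻¹-⟨$⟩ : ∀ v → σ ⁻¹ ⟨$⟩ σ ⟨$⟩ v ≡ v
    ⁻¹-⟨$⟩ = Inverse.strictlyInverseʳ (perm σ)

    ⟨$⟩-injective : ∀ {u w} → σ ⟨$⟩ u ≡ σ ⟨$⟩ w → u ≡ w
    ⟨$⟩-injective = Injection.injective (↔⇒↣ (perm σ))

  Simplicial : V H → Set
  Simplicial v = ∀ {p q} → Adj H v p → Adj H v q → p ≢ q → Adj H p q

  simplicial-preserved : (σ : Automorphism H) → ∀ {v} → Simplicial v → Simplicial (σ ⟨$⟩ v)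
  simplicial-preserved σ {v} simplicial {p} {q} vp vq p≢q =
    subst₂ (Adj H) (⟨$⟩-⁻¹ σ p) (⟨$⟩-⁻¹ σ q)
      (⟨$⟩-preserves σ (simplicial (pull vp) (pull vq) (p≢q ∘ ⟨$⟩-injective (σ ⁻¹))))
    where
    pull : ∀ {w} → Adj H (σ ⟨$⟩ v) w → Adj H v (σ ⁻¹ ⟨$⟩ w)
    pull {w} a = ⟨$⟩-reflects σ (subst (Adj H (σ ⟨$⟩ v)) (sym (⟨$⟩-⁻¹ σ w)) a)

complete-automorphism : Fin n ↔ Fin n → Automorphism (K n)
complete-automorphism π = record
  { perm = π
  ; preserve = λ i j → mk⇔ (λ i≢j e → i≢j (Injection.injective (↔⇒↣ π) e))
                           (λ πi≢πj e → πi≢πj (cong (Inverse.to π) e))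
  }

module _ {G : Graph} (g : V G → V G) where

  functigraph-automorphism : (α β : Automorphism G) → (∀ a → g (α ⟨$⟩ a) ≡ β ⟨$⟩ g a) →
    Automorphism (Functigraph G g)
  functigraph-automorphism α β commute = record
    { perm = mk↔ₛ′ (Sum.map (α ⟨$⟩_) (β ⟨$⟩_)) (Sum.map (α ⁻¹ ⟨$⟩_) (β ⁻¹ ⟨$⟩_)) to-from from-to
    ; preserve = preserves
    }
    where
    to-from : ∀ v → Sum.map (α ⟨$⟩_) (β ⟨$⟩_) (Sum.map (α ⁻¹ ⟨$⟩_) (β ⁻¹ ⟨$⟩_) v) ≡ v
    to-from (inj₁ a) = cong inj₁ (⟨$⟩-⁻¹ α a)
    to-from (inj₂ b) = cong inj₂ (⟨$⟩-⁻¹ β b)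
    from-to : ∀ v → Sum.map (α ⁻¹ ⟨$⟩_) (β ⁻¹ ⟨$⟩_) (Sum.map (α ⟨$⟩_) (β ⟨$⟩_) v) ≡ v
    from-to (inj₁ a) = cong inj₁ (⁻¹-⟨$⟩ α a)
    from-to (inj₂ b) = cong inj₂ (⁻¹-⟨$⟩ β b)
    edge : ∀ a b → g a ≡ b ⇔ g (α ⟨$⟩ a) ≡ β ⟨$⟩ b
    edge a b = mk⇔ (λ e → trans (commute a) (cong (β ⟨$⟩_) e))
                   (λ e → ⟨$⟩-injective β (trans (sym (commute a)) e))
    preserves : ∀ u v → Adj (Functigraph G g) u v ⇔
                        Adj (Functigraph G g) (Sum.map (α ⟨$⟩_) (β ⟨$⟩_) u) (Sum.map (α ⟨$⟩_) (β ⟨$⟩_) v)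
    preserves (inj₁ a) (inj₁ a′) = preserve α a a′
    preserves (inj₂ b) (inj₂ b′) = preserve β b b′
    preserves (inj₁ a) (inj₂ b) = edge a b
    preserves (inj₂ b) (inj₁ a) = edge a b

-- The functigraph of a complete graph

module FunctigraphOfComplete {n : ℕ} (g : Fin n → Fin n) where

  F : Graph
  F = Functigraph (K n) g

  Matched : Pred (Fin n) 0ℓ
  Matched b = ∃[ a ] g a ≡ b

  Matched? : Decidable Matched
  Matched? b = any? (λ a → g a ≟ b)

  Unmatched : Pred (Fin n) 0ℓ
  Unmatched = ∁ Matched

  Unmatched? : Decidable Unmatched
  Unmatched? = ∁? Matched?

  Singleton : Pred (Fin n) 0ℓ
  Singleton a = ∀ a′ → g a′ ≡ g a → a′ ≡ a

  Singleton? : Decidable Singleton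
  Singleton? a = all? (λ a′ → (g a′ ≟ g a) →-dec (a′ ≟ a))

  non-singleton-witness : ∀ {a} → ¬ Singleton a → ∃[ a′ ] a′ ≢ a × g a′ ≡ g a
  non-singleton-witness {a} ¬s with ¬∀⟶∃¬ n _ (λ a′ → (g a′ ≟ g a) →-dec (a′ ≟ a)) ¬s
  ... | a′ , ¬only with g a′ ≟ g a | a′ ≟ a
  ...   | yes ga′≡ga | no a′≢a = a′ , a′≢a , ga′≡ga
  ...   | yes _ | yes a′≡a = ⊥-elim (¬only (λ _ → a′≡a))
  ...   | no ga′≢ga | _ = ⊥-elim (¬only (λ ga′≡ga → ⊥-elim (ga′≢ga ga′≡ga)))

  _≈ᴬ_ : Rel (Fin n) 0ℓ
  a ≈ᴬ a′ = g a ≡ g a′ ⊎ (Singleton a × Singleton a′)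

  _≈ᴬ?_ : Binary.Decidable _≈ᴬ_
  a ≈ᴬ? a′ = (g a ≟ g a′) ⊎-dec (Singleton? a ×-dec Singleton? a′)

  ≈ᴬ-isPartialEquivalence : IsPartialEquivalence _≈ᴬ_
  ≈ᴬ-isPartialEquivalence = record { sym = ≈-sym ; trans = ≈-trans }
    where
    ≈-sym : ∀ {a a′} → a ≈ᴬ a′ → a′ ≈ᴬ a
    ≈-sym (inj₁ e) = inj₁ (sym e)
    ≈-sym (inj₂ (s , s′)) = inj₂ (s′ , s)
    ≈-trans : ∀ {a a′ a″} → a ≈ᴬ a′ → a′ ≈ᴬ a″ → a ≈ᴬ a″
    ≈-trans (inj₁ e) (inj₁ e′) = inj₁ (trans e e′)
    ≈-trans {a} (inj₁ e) (inj₂ (s′ , s″)) = inj₂ (subst Singleton (sym (s′ a e)) s′ , s″)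
    ≈-trans {a″ = a″} (inj₂ (s , s′)) (inj₁ e′) = inj₂ (s , subst Singleton (sym (s′ a″ (sym e′))) s′)
    ≈-trans (inj₂ (s , _)) (inj₂ (_ , s″)) = inj₂ (s , s″)

  ≈ᴬ-non-singleton : ∀ {a a′} → ¬ Singleton a → a ≈ᴬ a′ → g a ≡ g a′
  ≈ᴬ-non-singleton _ (inj₁ e) = e
  ≈ᴬ-non-singleton ¬s (inj₂ (s , _)) = ⊥-elim (¬s s)

  _≈ᴮ_ : Rel (Fin n) 0ℓ
  b ≈ᴮ b′ = Unmatched b × Unmatched b′

  _≈ᴮ?_ : Binary.Decidable _≈ᴮ_
  b ≈ᴮ? b′ = Unmatched? b ×-dec Unmatched? b′

  ≈ᴮ-isPartialEquivalence : IsPartialEquivalence _≈ᴮ_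
  ≈ᴮ-isPartialEquivalence = record
    { sym = λ (u , u′) → u′ , u
    ; trans = λ (u , _) (_ , u″) → u , u″
    }

  module ≈ᴬ = PartialEquivalence _≈ᴬ?_ ≈ᴬ-isPartialEquivalence
  module ≈ᴮ = PartialEquivalence _≈ᴮ?_ ≈ᴮ-isPartialEquivalence

  S₀ : List (Fin n ⊎ Fin n)
  S₀ = filter⊎ ≈ᴬ.NotLast? ≈ᴮ.NotLast?

  module _ {S : List (Fin n ⊎ Fin n)} (fixing : IsFixingSet F S) where

    open DecMembership {A = Fin n ⊎ Fin n} (≡-dec _≟_ _≟_) using (_∈?_)

    pair-fixing-S-is-identity : (α β : Perm.Permutation′ n) →
      (∀ a → g (α Perm.⟨$⟩ʳ a) ≡ β Perm.⟨$⟩ʳ g a) →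
      (∀ {a} → inj₁ a ∈ S → α Perm.⟨$⟩ʳ a ≡ a) → (∀ {b} → inj₂ b ∈ S → β Perm.⟨$⟩ʳ b ≡ b) →
      (∀ a → α Perm.⟨$⟩ʳ a ≡ a) × (∀ b → β Perm.⟨$⟩ʳ b ≡ b)
    pair-fixing-S-is-identity α β commute fixes₁ fixes₂ =
      (λ a → inj₁-injective (identity (inj₁ a))) , (λ b → inj₂-injective (identity (inj₂ b)))
      where
      σ : Automorphism F
      σ = functigraph-automorphism g (complete-automorphism α) (complete-automorphism β) commute
      identity : ∀ v → σ ⟨$⟩ v ≡ v
      identity = fixing σ λ { (inj₁ a) a∈ → cong inj₁ (fixes₁ a∈) ; (inj₂ b) b∈ → cong inj₂ (fixes₂ b∈) }

    transposition-fixes : ∀ (f : Fin n → Fin n ⊎ Fin n) {i j x} → f i ∉ S → f j ∉ S → f x ∈ S →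
      transpose i j x ≡ x
    transposition-fixes f i∉ j∉ x∈ =
      transpose-other (λ x≡i → i∉ (subst (λ z → f z ∈ S) x≡i x∈)) (λ x≡j → j∉ (subst (λ z → f z ∈ S) x≡j x∈))

    fibre-transposition : ∀ {a₁ a₂} → a₁ ≢ a₂ → g a₁ ≡ g a₂ → inj₁ a₁ ∉ S → inj₁ a₂ ∉ S → ⊥
    fibre-transposition {a₁} {a₂} a₁≢a₂ ga₁≡ga₂ ∉₁ ∉₂ =
      a₁≢a₂ (trans (sym a₁-fixed) (transpose-ˡ a₁ a₂))
      where
      a₁-fixed : transpose a₁ a₂ a₁ ≡ a₁
      a₁-fixed = proj₁ (pair-fixing-S-is-identity (Perm.transpose a₁ a₂) Perm.id (transpose-fibre g ga₁≡ga₂)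
                          (transposition-fixes inj₁ ∉₁ ∉₂) (λ _ → refl)) a₁

    unmatched-transposition : ∀ {b₁ b₂} → b₁ ≢ b₂ → Unmatched b₁ → Unmatched b₂ →
      inj₂ b₁ ∉ S → inj₂ b₂ ∉ S → ⊥
    unmatched-transposition {b₁} {b₂} b₁≢b₂ u₁ u₂ ∉₁ ∉₂ =
      b₁≢b₂ (trans (sym b₁-fixed) (transpose-ˡ b₁ b₂))
      where
      b₁-fixed : transpose b₁ b₂ b₁ ≡ b₁
      b₁-fixed = proj₂ (pair-fixing-S-is-identity Perm.id (Perm.transpose b₁ b₂)
                          (λ a → sym (transpose-other (λ e → u₁ (a , e)) (λ e → u₂ (a , e))))
                          (λ _ → refl) (transposition-fixes inj₂ ∉₁ ∉₂)) b₁

    singleton-transposition : ∀ {a₁ a₂} → a₁ ≢ a₂ → Singleton a₁ → Singleton a₂ →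
      inj₁ a₁ ∉ S → inj₂ (g a₁) ∉ S → inj₁ a₂ ∉ S → inj₂ (g a₂) ∉ S → ⊥
    singleton-transposition {a₁} {a₂} a₁≢a₂ s₁ s₂ ∉₁ ∉g₁ ∉₂ ∉g₂ =
      a₁≢a₂ (trans (sym a₁-fixed) (transpose-ˡ a₁ a₂))
      where
      a₁-fixed : transpose a₁ a₂ a₁ ≡ a₁
      a₁-fixed = proj₁ (pair-fixing-S-is-identity (Perm.transpose a₁ a₂) (Perm.transpose (g a₁) (g a₂))
                          (transpose-natural g (s₁ _) (s₂ _))
                          (transposition-fixes inj₁ ∉₁ ∉₂) (transposition-fixes inj₂ ∉g₁ ∉g₂)) a₁

    -- For a singleton a, fixing inj₂ (g a) also fixes inj₁ a, its only neighbour in A.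
    Touchedᴬ : Pred (Fin n) 0ℓ
    Touchedᴬ a = inj₁ a ∈ S ⊎ (Singleton a × inj₂ (g a) ∈ S)

    Touchedᴬ? : Decidable Touchedᴬ
    Touchedᴬ? a = (inj₁ a ∈? S) ⊎-dec (Singleton? a ×-dec (inj₂ (g a) ∈? S))

    Touchedᴮ : Pred (Fin n) 0ℓ
    Touchedᴮ b = Unmatched b × inj₂ b ∈ S

    Touchedᴮ? : Decidable Touchedᴮ
    Touchedᴮ? b = Unmatched? b ×-dec (inj₂ b ∈? S)

    ≈ᴬ-touched : ∀ {a a′} → a ≈ᴬ a′ → a ≢ a′ → Touchedᴬ a ⊎ Touchedᴬ a′
    ≈ᴬ-touched {a} {a′} related a≢a′ with Touchedᴬ? a | Touchedᴬ? a′ | related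
    ... | yes t | _ | _ = inj₁ t
    ... | no _ | yes t′ | _ = inj₂ t′
    ... | no ¬t | no ¬t′ | inj₁ ga≡ga′ = ⊥-elim (fibre-transposition a≢a′ ga≡ga′ (¬t ∘ inj₁) (¬t′ ∘ inj₁))
    ... | no ¬t | no ¬t′ | inj₂ (s , s′) = ⊥-elim (singleton-transposition a≢a′ s s′
            (¬t ∘ inj₁) (λ m → ¬t (inj₂ (s , m))) (¬t′ ∘ inj₁) (λ m → ¬t′ (inj₂ (s′ , m))))

    ≈ᴮ-touched : ∀ {b b′} → b ≈ᴮ b′ → b ≢ b′ → Touchedᴮ b ⊎ Touchedᴮ b′
    ≈ᴮ-touched {b} {b′} (u , u′) b≢b′ with inj₂ b ∈? S | inj₂ b′ ∈? S
    ... | yes b∈ | _ = inj₁ (u , b∈)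
    ... | no _ | yes b′∈ = inj₂ (u′ , b′∈)
    ... | no b∉ | no b′∉ = ⊥-elim (unmatched-transposition b≢b′ u u′ b∉ b′∉)

    count-touched-≤-length : count Touchedᴬ? + count Touchedᴮ? ≤ length S
    count-touched-≤-length = subst (_≤ length S) (length-filter⊎ Touchedᴬ? Touchedᴮ?)
      (length-≤-injection witness (filter⊎-unique Touchedᴬ? Touchedᴮ?)
        (into ∘ ∈-filter⊎⁻ Touchedᴬ? Touchedᴮ?)
        (λ v∈ w∈ → injective (∈-filter⊎⁻ Touchedᴬ? Touchedᴮ? v∈) (∈-filter⊎⁻ Touchedᴬ? Touchedᴮ? w∈)))
      where
      witness : Fin n ⊎ Fin n → Fin n ⊎ Fin n
      witness (inj₁ a) with inj₁ a ∈? S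
      ... | yes _ = inj₁ a
      ... | no _ = inj₂ (g a)
      witness (inj₂ b) = inj₂ b

      into : ∀ {v} → SumAll.All Touchedᴬ Touchedᴮ v → witness v ∈ S
      into (SumAll.inj₁ {a} t) with inj₁ a ∈? S | t
      ... | yes a∈ | _ = a∈
      ... | no a∉ | inj₁ a∈ = ⊥-elim (a∉ a∈)
      ... | no _ | inj₂ (_ , ga∈) = ga∈
      into (SumAll.inj₂ (_ , b∈)) = b∈

      injective : ∀ {v w} → SumAll.All Touchedᴬ Touchedᴮ v → SumAll.All Touchedᴬ Touchedᴮ w →
        witness v ≡ witness w → v ≡ w
      injective (SumAll.inj₁ {a} t) (SumAll.inj₁ {a′} t′) e with inj₁ a ∈? S | inj₁ a′ ∈? S | t
      ... | yes _ | yes _ | _ = e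
      injective (SumAll.inj₁ _) (SumAll.inj₁ _) () | yes _ | no _ | _
      injective (SumAll.inj₁ _) (SumAll.inj₁ _) () | no _ | yes _ | _
      ... | no a∉ | no _ | inj₁ a∈ = ⊥-elim (a∉ a∈)
      ... | no _ | no _ | inj₂ (s , _) = cong inj₁ (sym (s a′ (sym (inj₂-injective e))))
      injective (SumAll.inj₁ {a} _) (SumAll.inj₂ (u , _)) e with inj₁ a ∈? S
      injective (SumAll.inj₁ _) (SumAll.inj₂ _) () | yes _
      ... | no _ = ⊥-elim (u (a , inj₂-injective e))
      injective (SumAll.inj₂ (u , _)) (SumAll.inj₁ {a} _) e with inj₁ a ∈? S
      injective (SumAll.inj₂ _) (SumAll.inj₁ _) () | yes _
      ... | no _ = ⊥-elim (u (a , sym (inj₂-injective e)))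
      injective (SumAll.inj₂ _) (SumAll.inj₂ _) e = e

    lower-bound : length S₀ ≤ length S
    lower-bound = begin
      length S₀                               ≡⟨ length-filter⊎ ≈ᴬ.NotLast? ≈ᴮ.NotLast? ⟩
      count ≈ᴬ.NotLast? + count ≈ᴮ.NotLast?   ≤⟨ +-mono-≤ (≈ᴬ.count-NotLast-≤ Touchedᴬ? ≈ᴬ-touched)
                                                           (≈ᴮ.count-NotLast-≤ Touchedᴮ? ≈ᴮ-touched) ⟩
      count Touchedᴬ? + count Touchedᴮ?       ≤⟨ count-touched-≤-length ⟩
      length S                                ∎
      where open ≤-Reasoning

  unmatched-simplicial : ∀ {b} → Unmatched b → Simplicial {F} (inj₂ b)
  unmatched-simplicial u {inj₁ a} ga≡b _ _ = ⊥-elim (u (a , ga≡b))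
  unmatched-simplicial u {inj₂ _} {inj₁ a} _ ga≡b _ = ⊥-elim (u (a , ga≡b))
  unmatched-simplicial u {inj₂ _} {inj₂ _} _ _ p≢q = λ p≡q → p≢q (cong inj₂ p≡q)

  unmatched-neighbour : ∀ {b v} → Unmatched b → Adj F (inj₂ b) v → ∃[ b′ ] v ≡ inj₂ b′
  unmatched-neighbour {v = inj₁ a} u ga≡b = ⊥-elim (u (a , ga≡b))
  unmatched-neighbour {v = inj₂ b′} _ _ = b′ , refl

  module _ {b₀ : Fin n} (b₀-unmatched : Unmatched b₀) (nonconstant : ∀ a → ∃[ a′ ] g a′ ≢ g a) where

    simplicial⇒unmatched : ∀ {v} → Simplicial {F} v → ∃[ b ] v ≡ inj₂ b × Unmatched b
    simplicial⇒unmatched {inj₁ a} simplicial with nonconstant a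
    ... | a′ , ga′≢ga = ⊥-elim (ga′≢ga (simplicial {inj₁ a′} {inj₂ (g a)}
            (λ a≡a′ → ga′≢ga (cong g (sym a≡a′))) refl (λ ())))
    simplicial⇒unmatched {inj₂ b} simplicial with Matched? b
    ... | no u = b , refl , u
    ... | yes (x , gx≡b) with nonconstant x
    ...   | a′ , ga′≢gx = ⊥-elim (ga′≢gx (sym (simplicial {inj₁ x} {inj₂ (g a′)}
              gx≡b (λ b≡ga′ → ga′≢gx (trans (sym b≡ga′) (sym gx≡b))) (λ ()))))

    side-B : (σ : Automorphism F) → ∀ b → ∃[ b′ ] σ ⟨$⟩ inj₂ b ≡ inj₂ b′
    side-B σ b with simplicial⇒unmatched {σ ⟨$⟩ inj₂ b₀}
                      (simplicial-preserved σ {inj₂ b₀} (unmatched-simplicial b₀-unmatched)) | b ≟ b₀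
    ... | b₁ , σb₀≡b₁ , _ | yes refl = b₁ , σb₀≡b₁
    ... | b₁ , σb₀≡b₁ , u₁ | no b≢b₀ = unmatched-neighbour u₁
            (subst (λ w → Adj F w (σ ⟨$⟩ inj₂ b)) σb₀≡b₁ (⟨$⟩-preserves σ {inj₂ b₀} {inj₂ b} (b≢b₀ ∘ sym)))

    side-A : (σ : Automorphism F) → ∀ a → ∃[ a′ ] σ ⟨$⟩ inj₁ a ≡ inj₁ a′
    side-A σ a with σ ⟨$⟩ inj₁ a in σa≡
    ... | inj₁ a′ = a′ , refl
    ... | inj₂ b with side-B (σ ⁻¹) b
    ...   | b′ , σ⁻¹b≡b′
            with trans (sym (trans (cong (σ ⁻¹ ⟨$⟩_) (sym σa≡)) (⁻¹-⟨$⟩ σ (inj₁ a)))) σ⁻¹b≡b′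
    ...     | ()

    module Components (σ : Automorphism F) where

      α β : Fin n → Fin n
      α a = proj₁ (side-A σ a)
      β b = proj₁ (side-B σ b)

      α-spec : ∀ a → σ ⟨$⟩ inj₁ a ≡ inj₁ (α a)
      α-spec a = proj₂ (side-A σ a)

      β-spec : ∀ b → σ ⟨$⟩ inj₂ b ≡ inj₂ (β b)
      β-spec b = proj₂ (side-B σ b)

      α-injective : Injective _≡_ _≡_ α
      α-injective {x} {y} e =
        inj₁-injective (⟨$⟩-injective σ (trans (α-spec x) (trans (cong inj₁ e) (sym (α-spec y)))))

      β-injective : Injective _≡_ _≡_ β
      β-injective {x} {y} e =
        inj₂-injective (⟨$⟩-injective σ (trans (β-spec x) (trans (cong inj₂ e) (sym (β-spec y)))))

      α-surjective : ∀ a → ∃[ a′ ] α a′ ≡ a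
      α-surjective a with side-A (σ ⁻¹) a
      ... | a′ , σ⁻¹a≡a′ = a′ , inj₁-injective (trans (sym (α-spec a′))
                              (trans (cong (σ ⟨$⟩_) (sym σ⁻¹a≡a′)) (⟨$⟩-⁻¹ σ (inj₁ a))))

      commute : ∀ a → g (α a) ≡ β (g a)
      commute a = subst₂ (Adj F) (α-spec a) (β-spec (g a)) (⟨$⟩-preserves σ {inj₁ a} {inj₂ (g a)} refl)

    S₀-fixing : IsFixingSet F S₀
    S₀-fixing σ fixes = λ { (inj₁ a) → trans (α-spec a) (cong inj₁ (α-id a))
                          ; (inj₂ b) → trans (β-spec b) (cong inj₂ (β-id b)) }
      where
      open Components σ

      fixes-NotLast : ∀ {v} → SumAll.All ≈ᴬ.NotLast ≈ᴮ.NotLast v → σ ⟨$⟩ v ≡ v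
      fixes-NotLast notLast = fixes _ (∈-filter⊎⁺ ≈ᴬ.NotLast? ≈ᴮ.NotLast? notLast)

      α-NotLast : ∀ {a} → ≈ᴬ.NotLast a → α a ≡ a
      α-NotLast {a} notLast = inj₁-injective (trans (sym (α-spec a)) (fixes-NotLast (SumAll.inj₁ notLast)))

      β-NotLast : ∀ {b} → ≈ᴮ.NotLast b → β b ≡ b
      β-NotLast {b} notLast = inj₂-injective (trans (sym (β-spec b)) (fixes-NotLast (SumAll.inj₂ notLast)))

      α-singleton : ∀ {a} → Singleton a → Singleton (α a)
      α-singleton {a} s x gx≡gαa with α-surjective x
      ... | y , refl = cong α (s y (β-injective (trans (sym (commute y)) (trans gx≡gαa (commute a)))))

      fibre-fixed : ∀ {a c} → g c ≡ g a → α c ≡ c → g (α a) ≡ g a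
      fibre-fixed {a} {c} gc≡ga αc≡c = begin
        g (α a) ≡⟨ commute a ⟩
        β (g a) ≡⟨ cong β (sym gc≡ga) ⟩
        β (g c) ≡⟨ sym (commute c) ⟩
        g (α c) ≡⟨ cong g αc≡c ⟩
        g c     ≡⟨ gc≡ga ⟩
        g a     ∎
        where open ≡-Reasoning

      α-≈ᴬ : ∀ a → a ≈ᴬ α a
      α-≈ᴬ a with Singleton? a
      ... | yes s = inj₂ (s , α-singleton s)
      ... | no ¬s with non-singleton-witness ¬s
      ...   | a′ , a′≢a , ga′≡ga with ≈ᴬ.NotLast-or-NotLast (inj₁ ga′≡ga) a′≢a
      ...     | inj₁ a′-notLast = inj₁ (sym (fibre-fixed ga′≡ga (α-NotLast a′-notLast)))
      ...     | inj₂ a-notLast = inj₁ (sym (fibre-fixed refl (α-NotLast a-notLast)))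

      α-id : ∀ a → α a ≡ a
      α-id a = ≈ᴬ.class-preserving-injection-fixes α α-injective (λ {x} _ → α-≈ᴬ x) α-NotLast (inj₁ refl)

      β-unmatched : ∀ {b} → Unmatched b → Unmatched (β b)
      β-unmatched u (x , gx≡βb) with α-surjective x
      ... | y , refl = u (y , β-injective (trans (sym (commute y)) gx≡βb))

      β-id : ∀ b → β b ≡ b
      β-id b with Matched? b
      ... | yes (a , refl) = trans (sym (commute a)) (cong g (α-id a))
      ... | no u =
        ≈ᴮ.class-preserving-injection-fixes β β-injective (λ (u , _) → u , β-unmatched u) β-NotLast (u , u)

  imageSize≡count : imageSize g ≡ count Matched?
  imageSize≡count = ∣tabulate∣≡count Matched?

  nonconstant-from-count : 1 < count Matched? → ∀ a → ∃[ a′ ] g a′ ≢ g a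
  nonconstant-from-count 1<s a with 1<count⇒∃≢ Matched? 1<s (g a)
  ... | _ , (a′ , refl) , ga′≢ga = a′ , ga′≢ga

  unmatched-from-count : count Matched? < n → ∃[ b ] Unmatched b
  unmatched-from-count s<n = 0<count⇒∃ Unmatched? (+-cancelˡ-< (count Matched?) 0 (count Unmatched?)
    (subst₂ _<_ (sym (+-identityʳ _)) (sym (count-∁ Matched?)) s<n))

  non-singleton-from-count : count Matched? < n → ∃[ a ] ¬ Singleton a
  non-singleton-from-count s<n with all? Singleton?
  ... | no ¬all = ¬∀⟶∃¬ n Singleton Singleton? ¬all
  ... | yes all = ⊥-elim (<⇒≱ s<n (subst (_≤ count Matched?) count-U
          (count-≤-injection U? Matched? g (λ {a} _ → a , refl) (λ {a} {a′} _ _ e → all a′ a e))))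

  classes-≤-image : count (∁? ≈ᴬ.NotLast?) ≤ count Matched?
  classes-≤-image = count-≤-injection (∁? ≈ᴬ.NotLast?) Matched? g (λ {a} _ → a , refl)
    (λ last last′ e → ≈ᴬ.last-unique (inj₁ e) last last′)

  two-≤-classes : ∀ {a₀} → ¬ Singleton a₀ → (∀ a → ∃[ a′ ] g a′ ≢ g a) → 2 ≤ count (∁? ≈ᴬ.NotLast?)
  two-≤-classes {a₀} ¬s nonconstant with nonconstant a₀
  ... | a₁ , ga₁≢ga₀ =
    2≤count (∁? ≈ᴬ.NotLast?) (≈ᴬ.last-not-NotLast (inj₁ refl)) (≈ᴬ.last-not-NotLast (inj₁ refl)) distinct
    where
    open IsPartialEquivalence ≈ᴬ-isPartialEquivalence renaming (sym to ≈-sym; trans to ≈-trans)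
    distinct : ≈ᴬ.last a₀ ≢ ≈ᴬ.last a₁
    distinct e = ga₁≢ga₀ (sym (≈ᴬ-non-singleton ¬s (≈-trans (≈ᴬ.last-related (inj₁ refl))
                   (subst (_≈ᴬ a₁) (sym e) (≈-sym (≈ᴬ.last-related (inj₁ refl)))))))

  unmatched-count : ∀ {b₀} → Unmatched b₀ → count ≈ᴮ.NotLast? + 1 ≡ count Unmatched?
  unmatched-count {b₀} u₀ =
    trans (cong (count ≈ᴮ.NotLast? +_) (sym one-last))
          (count-split Unmatched? ≈ᴮ.NotLast? (proj₁ ∘ ≈ᴮ.NotLast⇒reflexive))
    where
    Last? : Decidable (Unmatched ∩ ∁ ≈ᴮ.NotLast)
    Last? = Unmatched? ∩? ∁? ≈ᴮ.NotLast?
    one-last : count Last? ≡ 1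
    one-last = ≤-antisym
      (count≤1 Last? (λ (u , last) (u′ , last′) → ≈ᴮ.last-unique (u , u′) last last′))
      (1≤count Last? (proj₂ (≈ᴮ.last-related (u₀ , u₀)) , ≈ᴮ.last-not-NotLast (u₀ , u₀)))

  module _ (1<s : 1 < count Matched?) (s<n : count Matched? < n) where

    private
      nonconstant : ∀ a → ∃[ a′ ] g a′ ≢ g a
      nonconstant = nonconstant-from-count 1<s

      unmatched : ∃[ b ] Unmatched b
      unmatched = unmatched-from-count s<n

    S₀-isFixNumber : IsFixNumber F (length S₀)
    S₀-isFixNumber =
      (S₀ , filter⊎-unique ≈ᴬ.NotLast? ≈ᴮ.NotLast? , S₀-fixing (proj₂ unmatched) nonconstant , refl) ,
      λ _ _ → lower-bound

    length-S₀-bounds : 2 * (n ∸ count Matched?) ∸ 1 ≤ length S₀ × length S₀ ≤ 2 * n ∸ count Matched? ∸ 3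
    length-S₀-bounds rewrite length-filter⊎ ≈ᴬ.NotLast? ≈ᴮ.NotLast? =
      bounds-from-class-count (count-∁ ≈ᴬ.NotLast?)
        (trans (cong (count Matched? +_) (unmatched-count (proj₂ unmatched))) (count-∁ Matched?))
        (two-≤-classes (proj₂ (non-singleton-from-count s<n)) nonconstant) classes-≤-image

-- The hypothesis 3 ≤ n is implied by 1 < s < n.
mainTheorem8 : (n : ℕ) → 3 ≤ n → (g : Fin n → Fin n) →
    1 < imageSize g → imageSize g < n →
    ∃[ k ] (IsFixNumber (Functigraph (K n) g) k ×
    2 * (n ∸ imageSize g) ∸ 1 ≤ k × k ≤ 2 * n ∸ imageSize g ∸ 3)
mainTheorem8 n _ g rewrite FunctigraphOfComplete.imageSize≡count g =
  λ 1<s s<n → length S₀ , S₀-isFixNumber 1<s s<n , length-S₀-bounds 1<s s<n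
  where open FunctigraphOfComplete g
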